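{- Let $n\ge 4$ and $k\ge 1$ be integers. Then \[ \gamma_{[k]R}(C_5\Box P_n)\le 5(n-2)\left\lceil\frac{k+5}{5}\right\rceil+10\left\lceil\frac{k+3-\left\lceil\frac{k+5}{5}\right\rceil}{3}\right\rceil-n\le \frac{3nk+30n+2k-10}{3}. \]
   Context: For a graph $G$ and $v\in V(G)$, $N(v)$ is the open neighborhood and $N[v]=N(v)\cup\{v\}$. For an integer $k\ge1$, a function $f:V(G)\to\{0,1,\dots,k+1\}$ is a $[k]$-Roman dominating function if for every vertex $v$ with $f(v)<k$ we have $\sum_{u\in N[v]}f(u)\ge k+|\{u\in N(v): f(u)>0\}|$. The weight of $f$ is $\sum_{v}f(v)$, and $\gamma_{[k]R}(G)$ is the minimum weight of a $[k]$-Roman dominating function on $G$. $C_m\Box P_n$ is the Cartesian product of the cycle $C_m$ (vertices $0,\dots,m-1$ mod $m$) and the path $P_n$ (vertices $0,\dots,n-1$): $(i,j)\sim(i',j')$ iff ($i=i'$ and $|j-j'|=1$) or ($j=j'$ and $i'\equiv i\pm1 \pmod m$). -}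

module Defs where

open import Data.Nat using (ℕ; zero; suc; _+_; _*_; _∸_; _≤_; _<_; _/_; _%_; NonZero)
open import Data.Nat.Properties using (_≟_)
open import Data.Fin using (Fin; toℕ)
open import Data.Bool using (Bool; true; false; if_then_else_; _∧_; _∨_)
open import Data.Nat.ListAction using (sum)
open import Data.List using (List; map; length; filter; allFin; cartesianProduct)
open import Data.Product using (_×_; _,_; proj₁; proj₂)
open import Relation.Nullary.Decidable using (⌊_⌋)
open import Data.Nat using (_<ᵇ_)

Vertex : ℕ → ℕ → Set
Vertex m n = Fin m × Fin n

vertices : (m n : ℕ) → List (Vertex m n)
vertices m n = cartesianProduct (allFin m) (allFin n)

_==_ : ℕ → ℕ → Bool
a == b = ⌊ a ≟ b ⌋

cycAdj : (m : ℕ) .{{_ : NonZero m}} → Fin m → Fin m → Bool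
cycAdj m i i' = (toℕ i' == ((toℕ i + 1) % m)) ∨ (toℕ i == ((toℕ i' + 1) % m))

pathAdj : (n : ℕ) → Fin n → Fin n → Bool
pathAdj n j j' = (toℕ j' == suc (toℕ j)) ∨ (toℕ j == suc (toℕ j'))

adj : (m n : ℕ) .{{_ : NonZero m}} → Vertex m n → Vertex m n → Bool
adj m n (i , j) (i' , j') =
  ((toℕ i == toℕ i') ∧ pathAdj n j j') ∨ ((toℕ j == toℕ j') ∧ cycAdj m i i')

N : (m n : ℕ) .{{_ : NonZero m}} → Vertex m n → List (Vertex m n)
N m n v = filter (λ u → Data.Bool.T? (adj m n v u)) (vertices m n)
  where import Data.Bool

weight : (m n : ℕ) → (Vertex m n → ℕ) → ℕ
weight m n f = sum (map f (vertices m n))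

IsKRDF : (k m n : ℕ) .{{_ : NonZero m}} → (Vertex m n → ℕ) → Set
IsKRDF k m n f =
  ((v : Vertex m n) → f v ≤ k + 1) ×
  ((v : Vertex m n) → f v < k →
     k + length (filter (λ u → 0 Data.Nat.<? f u) (N m n v))
       ≤ f v + sum (map f (N m n v)))
  where import Data.Nat

⌈_/_⌉ : ℕ → (b : ℕ) .{{_ : NonZero b}} → ℕ
⌈ a / b ⌉ = (a + b ∸ 1) / b

{-# OPTIONS --safe #-}
module Submission where

-- Put k = X + Y + Z with X = ⌊(k+2)/3⌋, Y = ⌊(k+1)/3⌋, Z = ⌊k/3⌋ and give the vertex (i , c) the
-- residue i + 2c (mod 5).  A vertex and its four neighbours in C₅ □ Pₙ then have five distinct
-- residues, except in the first and last column where one residue is missing.  Labelling residues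
-- 0, 1, 2 by X + 1, Y + 1, Z + 1 and residues 3, 4 by 0, every vertex v satisfies
-- f v + Σ_{u ∈ N v} (f u − 1)⁺ ≥ X + Y + Z = k, which implies the [k]-Roman condition; the end columns
-- are repaired by an extra label Z + 1 resp. X + 1.  The resulting weight is n(k + 3) + X + Z + 2,
-- and for n = 4 a variant saves one more unit.  Comparing with the bound of the theorem reduces,
-- through k + 5 ≤ 5c ≤ k + 9 and 3d + c ≤ k + 5, to 4k + 17 + Z + X ≤ 10(c + d); both sides of
-- this grow by 70 when k grows by 15, so it is checked on one period.

open import Defs
open import Data.Bool using (Bool; true; false; if_then_else_; _∧_; _∨_; T)
open import Data.Bool.Properties using (∧-identityʳ; ∧-zeroʳ; ∨-identityʳ)
open import Data.Fin using (Fin; toℕ; zero; suc)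
open import Data.Fin.Patterns using (0F; 1F; 2F; 3F; 4F)
open import Data.Fin.Properties using (toℕ<n; toℕ-injective)
open import Data.List using ([]; _∷_; _++_; map; filter; length; allFin; tabulate; cartesianProduct)
open import Data.List.Properties using (map-tabulate; map-++; map-∘)
open import Data.Nat
  using (ℕ; zero; suc; pred; _+_; _*_; _∸_; _≤_; _<_; _≡ᵇ_; _<ᵇ_; _<?_; _≤?_; _/_; _%_; z≤n; s≤s)
  using (NonZero; >-nonZero; allUpTo?)
open import Data.Nat.DivMod
  using (m≡m%n+[m/n]*n; m%n<n; +-distrib-/-∣ʳ; m*n/n≡m; m/n*n≤m; /-monoˡ-≤; m≥n⇒m/n>0)
open import Data.Nat.Divisibility using (divides-refl)
open import Data.Nat.ListAction using (sum)
open import Data.Nat.ListAction.Properties using (sum-++)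
open import Data.Nat.Properties
open import Algebra.Properties.CommutativeSemigroup +-commutativeSemigroup using (x∙yz≈y∙xz; xy∙z≈xz∙y)
open import Data.Nat.Tactic.RingSolver using (solve-∀; solve)
open import Data.Product using (Σ; _×_; _,_)
open import Data.Sum using (inj₁; inj₂)
open import Data.Unit using (tt)
open import Function using (_∘_)
open import Relation.Binary.PropositionalEquality
open import Relation.Nullary.Decidable using (T?; isYes≗does; toWitness; from-yes)
open import Algebra.Properties.CommutativeMonoid.Sum +-0-commutativeMonoid
  using (sum-syntax; ∑-comm; ∑-distrib-+; sum-cong-≗; sum-replicate-zero)
  renaming (sum to ∑)

-- Finite sums

sum-tabulate : ∀ {n} (g : Fin n → ℕ) → sum (tabulate g) ≡ ∑[ j < n ] g j
sum-tabulate {zero}  g = refl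
sum-tabulate {suc n} g = cong (g zero +_) (sum-tabulate (g ∘ suc))

sum-map-allFin : ∀ n (g : Fin n → ℕ) → sum (map g (allFin n)) ≡ ∑[ j < n ] g j
sum-map-allFin n g = trans (cong sum (map-tabulate (λ j → j) g)) (sum-tabulate g)

sum-map-cartesianProduct : ∀ {A B : Set} (g : A × B → ℕ) xs ys →
  sum (map g (cartesianProduct xs ys)) ≡ sum (map (λ x → sum (map (λ y → g (x , y)) ys)) xs)
sum-map-cartesianProduct g []       ys = refl
sum-map-cartesianProduct g (x ∷ xs) ys = begin
  sum (map g (map (x ,_) ys ++ cartesianProduct xs ys))
    ≡⟨ cong sum (map-++ g (map (x ,_) ys) _) ⟩
  sum (map g (map (x ,_) ys) ++ map g (cartesianProduct xs ys))
    ≡⟨ sum-++ (map g (map (x ,_) ys)) _ ⟩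
  sum (map g (map (x ,_) ys)) + sum (map g (cartesianProduct xs ys))
    ≡⟨ cong₂ _+_ (cong sum (sym (map-∘ ys))) (sum-map-cartesianProduct g xs ys) ⟩
  sum (map (λ y → g (x , y)) ys) + sum (map (λ x → sum (map (λ y → g (x , y)) ys)) xs) ∎
  where open ≡-Reasoning

sum-map-vertices : ∀ m n (g : Vertex m n → ℕ) →
  sum (map g (vertices m n)) ≡ ∑[ i < m ] ∑[ j < n ] g (i , j)
sum-map-vertices m n g = begin
  sum (map g (vertices m n))
    ≡⟨ sum-map-cartesianProduct g (allFin m) (allFin n) ⟩
  sum (map (λ i → sum (map (λ j → g (i , j)) (allFin n))) (allFin m))
    ≡⟨ sum-map-allFin m _ ⟩
  ∑[ i < m ] sum (map (λ j → g (i , j)) (allFin n))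
    ≡⟨ sum-cong-≗ (λ i → sum-map-allFin n (λ j → g (i , j))) ⟩
  ∑[ i < m ] ∑[ j < n ] g (i , j) ∎
  where open ≡-Reasoning

sum-map-filter : ∀ {A : Set} (p : A → Bool) (g : A → ℕ) xs →
  sum (map g (filter (λ x → T? (p x)) xs)) ≡ sum (map (λ x → if p x then g x else 0) xs)
sum-map-filter p g []       = refl
sum-map-filter p g (x ∷ xs) with p x
... | true  = cong (g x +_) (sum-map-filter p g xs)
... | false = sum-map-filter p g xs

sum-map≡count-positive+sum-map-pred : ∀ {A : Set} (g : A → ℕ) xs →
  sum (map g xs) ≡ length (filter (λ x → 0 <? g x) xs) + sum (map (λ x → g x ∸ 1) xs)
sum-map≡count-positive+sum-map-pred g []       = refl
sum-map≡count-positive+sum-map-pred g (x ∷ xs) with g x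
... | zero  = sum-map≡count-positive+sum-map-pred g xs
... | suc a = cong suc (trans (cong (a +_) (sum-map≡count-positive+sum-map-pred g xs))
                              (x∙yz≈y∙xz a (length (filter (λ x → 0 <? g x) xs)) _))

∑-const : ∀ n a → ∑[ j < n ] a ≡ n * a
∑-const zero    a = refl
∑-const (suc n) a = cong (a +_) (∑-const n a)

∑-point : ∀ n a (G : ℕ → ℕ) →
  ∑[ j < n ] (if a ≡ᵇ toℕ j then G (toℕ j) else 0) ≡ (if a <ᵇ n then G a else 0)
∑-point zero    a       G = refl
∑-point (suc n) zero    G = trans (cong (G 0 +_) (sum-replicate-zero n)) (+-identityʳ (G 0))
∑-point (suc n) (suc a) G = ∑-point n a (G ∘ suc)

∑-point-Fin : ∀ {n} (i : Fin n) (P : Fin n → ℕ) →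
  ∑[ i′ < n ] (if toℕ i ≡ᵇ toℕ i′ then P i′ else 0) ≡ P i
∑-point-Fin {suc n} zero    P = trans (cong (P zero +_) (sum-replicate-zero n)) (+-identityʳ (P zero))
∑-point-Fin {suc n} (suc i) P = ∑-point-Fin i (P ∘ suc)

-- Neighbourhoods in C₅ □ Pₙ

==≡≡ᵇ : ∀ a b → (a == b) ≡ (a ≡ᵇ b)
==≡≡ᵇ a b = isYes≗does (a ≟ b)

≡ᵇ-refl : ∀ a → (a ≡ᵇ a) ≡ true
≡ᵇ-refl zero    = refl
≡ᵇ-refl (suc a) = ≡ᵇ-refl a

if-T : ∀ {b} (x : ℕ) → T b → (if b then x else 0) ≡ x
if-T {true} x _ = refl

if-≤ : ∀ b {x m} → x ≤ m → (if b then x else 0) ≤ m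
if-≤ true  x≤m = x≤m
if-≤ false _   = z≤n

if-pathAdj-split : ∀ c m (g : ℕ) →
  (if (m ≡ᵇ suc c) ∨ (c ≡ᵇ suc m) then g else 0)
  ≡ (if c ≡ᵇ suc m then g else 0) + (if suc c ≡ᵇ m then g else 0)
if-pathAdj-split zero    zero          g = refl
if-pathAdj-split zero    (suc zero)    g = refl
if-pathAdj-split zero    (suc (suc m)) g = refl
if-pathAdj-split (suc c) zero          g = sym (+-identityʳ _)
if-pathAdj-split (suc c) (suc m)       g = if-pathAdj-split c m g

rot : Fin 5 → Fin 5
rot 0F = 1F
rot 1F = 2F
rot 2F = 3F
rot 3F = 4F
rot 4F = 0F

rot⁻¹ : Fin 5 → Fin 5
rot⁻¹ 0F = 4F
rot⁻¹ 1F = 0F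
rot⁻¹ 2F = 1F
rot⁻¹ 3F = 2F
rot⁻¹ 4F = 3F

rot⁻¹-rot : ∀ s → rot⁻¹ (rot s) ≡ s
rot⁻¹-rot 0F = refl
rot⁻¹-rot 1F = refl
rot⁻¹-rot 2F = refl
rot⁻¹-rot 3F = refl
rot⁻¹-rot 4F = refl

rot-rot⁻¹ : ∀ s → rot (rot⁻¹ s) ≡ s
rot-rot⁻¹ 0F = refl
rot-rot⁻¹ 1F = refl
rot-rot⁻¹ 2F = refl
rot-rot⁻¹ 3F = refl
rot-rot⁻¹ 4F = refl

label : ∀ {n} → (Fin 5 → ℕ → ℕ) → Vertex 5 n → ℕ
label h (i , j) = h i (toℕ j)

prev : (ℕ → ℕ) → ℕ → ℕ
prev G zero    = 0
prev G (suc c) = G c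

next : ℕ → (ℕ → ℕ) → ℕ → ℕ
next n G c = if suc c <ᵇ n then G (suc c) else 0

∑-prev : ∀ n c (G : ℕ → ℕ) → c ≤ n →
  ∑[ j < n ] (if c ≡ᵇ suc (toℕ j) then G (toℕ j) else 0) ≡ prev G c
∑-prev n zero    G _   = sum-replicate-zero n
∑-prev n (suc c) G c<n = trans (∑-point n c G) (if-T (G c) (<⇒<ᵇ c<n))

∑-pathAdj : ∀ n (j : Fin n) (G : ℕ → ℕ) →
  ∑[ j′ < n ] (if pathAdj n j j′ then G (toℕ j′) else 0) ≡ prev G (toℕ j) + next n G (toℕ j)
∑-pathAdj n j G = begin
  ∑[ j′ < n ] (if pathAdj n j j′ then G (toℕ j′) else 0) ≡⟨ sum-cong-≗ {n} split ⟩
  ∑[ j′ < n ] (below j′ + above j′)                       ≡⟨ ∑-distrib-+ {n} below above ⟩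
  ∑[ j′ < n ] below j′ + ∑[ j′ < n ] above j′             ≡⟨ cong₂ _+_ (∑-prev n c G (<⇒≤ (toℕ<n j)))
                                                                        (∑-point n (suc c) G) ⟩
  prev G c + next n G c                                   ∎
  where
  open ≡-Reasoning
  c : ℕ
  c = toℕ j
  below above : Fin n → ℕ
  below j′ = if c ≡ᵇ suc (toℕ j′) then G (toℕ j′) else 0
  above j′ = if suc c ≡ᵇ toℕ j′ then G (toℕ j′) else 0
  split : ∀ j′ → (if pathAdj n j j′ then G (toℕ j′) else 0) ≡ below j′ + above j′
  split j′ = trans (cong (λ b → if b then G (toℕ j′) else 0)
                         (cong₂ _∨_ (==≡≡ᵇ (toℕ j′) (suc c)) (==≡≡ᵇ c (suc (toℕ j′)))))
                   (if-pathAdj-split c (toℕ j′) (G (toℕ j′)))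

cycAdj-irrefl : ∀ i → cycAdj 5 i i ≡ false
cycAdj-irrefl 0F = refl
cycAdj-irrefl 1F = refl
cycAdj-irrefl 2F = refl
cycAdj-irrefl 3F = refl
cycAdj-irrefl 4F = refl

cycAdj-exclusive : ∀ i i′ → (toℕ i == toℕ i′) ≡ true → cycAdj 5 i i′ ≡ false
cycAdj-exclusive i i′ eq rewrite toℕ-injective (toWitness {a? = toℕ i ≟ toℕ i′} (subst T (sym eq) tt)) =
  cycAdj-irrefl i′

∑-cycAdj : ∀ i (Q : Fin 5 → ℕ) →
  ∑[ i′ < 5 ] (if cycAdj 5 i i′ then Q i′ else 0) ≡ Q (rot i) + Q (rot⁻¹ i)
∑-cycAdj 0F Q = cong (Q 1F +_) (+-identityʳ (Q 4F))
∑-cycAdj 1F Q = trans (cong (Q 0F +_) (+-identityʳ (Q 2F))) (+-comm (Q 0F) (Q 2F))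
∑-cycAdj 2F Q = trans (cong (Q 1F +_) (+-identityʳ (Q 3F))) (+-comm (Q 1F) (Q 3F))
∑-cycAdj 3F Q = trans (cong (Q 2F +_) (+-identityʳ (Q 4F))) (+-comm (Q 2F) (Q 4F))
∑-cycAdj 4F Q = cong (Q 0F +_) (+-identityʳ (Q 3F))

∑-row : ∀ n (j : Fin n) (G : ℕ → ℕ) (same cyc : Bool) → (same ≡ true → cyc ≡ false) →
  ∑[ j′ < n ] (if (same ∧ pathAdj n j j′) ∨ ((toℕ j == toℕ j′) ∧ cyc) then G (toℕ j′) else 0)
  ≡ (if same then prev G (toℕ j) + next n G (toℕ j) else 0) + (if cyc then G (toℕ j) else 0)
∑-row n j G true  true  excl with () ← excl refl
∑-row n j G true  false _ =
  trans (sum-cong-≗ {n} λ j′ → cong (λ b → if b then G (toℕ j′) else 0)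
                                    (trans (cong (pathAdj n j j′ ∨_) (∧-zeroʳ _)) (∨-identityʳ _)))
        (trans (∑-pathAdj n j G) (sym (+-identityʳ _)))
∑-row n j G false true  _ =
  trans (sum-cong-≗ {n} λ j′ → cong (λ b → if b then G (toℕ j′) else 0)
                                    (trans (∧-identityʳ _) (==≡≡ᵇ (toℕ j) (toℕ j′))))
        (trans (∑-point n (toℕ j) G) (if-T (G (toℕ j)) (<⇒<ᵇ (toℕ<n j))))
∑-row n j G false false _ =
  trans (sum-cong-≗ {n} λ j′ → cong (λ b → if b then G (toℕ j′) else 0) (∧-zeroʳ _))
        (sum-replicate-zero n)

sum-N-label : ∀ n (h : Fin 5 → ℕ → ℕ) i (j : Fin n) → let c = toℕ j in
  sum (map (label h) (N 5 n (i , j))) ≡ prev (h i) c + next n (h i) c + (h (rot i) c + h (rot⁻¹ i) c)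
sum-N-label n h i j = begin
  sum (map (label h) (N 5 n (i , j)))
    ≡⟨ sum-map-filter (adj 5 n (i , j)) (label h) (vertices 5 n) ⟩
  sum (map (λ u → if adj 5 n (i , j) u then label h u else 0) (vertices 5 n))
    ≡⟨ sum-map-vertices 5 n _ ⟩
  ∑[ i′ < 5 ] ∑[ j′ < n ] (if adj 5 n (i , j) (i′ , j′) then h i′ (toℕ j′) else 0)
    ≡⟨ sum-cong-≗ {5} (λ i′ → ∑-row n j (h i′) (toℕ i == toℕ i′) (cycAdj 5 i i′) (cycAdj-exclusive i i′)) ⟩
  ∑[ i′ < 5 ] (same i′ + cyc i′)
    ≡⟨ ∑-distrib-+ {5} same cyc ⟩
  ∑[ i′ < 5 ] same i′ + ∑[ i′ < 5 ] cyc i′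
    ≡⟨ cong₂ _+_ (trans (sum-cong-≗ {5} λ i′ → cong (λ b → if b then P i′ else 0) (==≡≡ᵇ (toℕ i) (toℕ i′)))
                        (∑-point-Fin i P))
                 (∑-cycAdj i (λ i′ → h i′ c)) ⟩
  P i + (h (rot i) c + h (rot⁻¹ i) c) ∎
  where
  open ≡-Reasoning
  c : ℕ
  c = toℕ j
  P same cyc : Fin 5 → ℕ
  P i′ = prev (h i′) c + next n (h i′) c
  same i′ = if toℕ i == toℕ i′ then P i′ else 0
  cyc i′ = if cycAdj 5 i i′ then h i′ c else 0

-- Coverage, and labellings constant along diagonals

coverage : (centre below above right left : ℕ) → ℕ
coverage centre below above right left =
  centre + ((below ∸ 1) + (above ∸ 1) + ((right ∸ 1) + (left ∸ 1)))

prev-∸ : ∀ G c → prev (λ c → G c ∸ 1) c ≡ prev G c ∸ 1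
prev-∸ G zero    = refl
prev-∸ G (suc c) = refl

next-∸ : ∀ n G c → next n (λ c → G c ∸ 1) c ≡ next n G c ∸ 1
next-∸ n G c with suc c <ᵇ n
... | true  = refl
... | false = refl

coverage-label : ∀ n (h : Fin 5 → ℕ → ℕ) i (j : Fin n) → let c = toℕ j in
  label h (i , j) + sum (map (λ u → label h u ∸ 1) (N 5 n (i , j)))
  ≡ coverage (h i c) (prev (h i) c) (next n (h i) c) (h (rot i) c) (h (rot⁻¹ i) c)
coverage-label n h i j =
  cong (h i c +_) (trans (sum-N-label n (λ i c → h i c ∸ 1) i j)
                         (cong (_+ (h (rot i) c ∸ 1 + (h (rot⁻¹ i) c ∸ 1)))
                               (cong₂ _+_ (prev-∸ (h i) c) (next-∸ n (h i) c))))
  where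
  c : ℕ
  c = toℕ j

isKRDF-from-coverage : ∀ {k m n} .{{_ : NonZero m}} (f : Vertex m n → ℕ) →
  (∀ v → f v ≤ k + 1) → (∀ v → k ≤ f v + sum (map (λ u → f u ∸ 1) (N m n v))) → IsKRDF k m n f
isKRDF-from-coverage {k} {m} {n} f bounded covered = bounded , λ v _ → begin
  k + count v                      ≤⟨ +-monoˡ-≤ (count v) (covered v) ⟩
  f v + excess v + count v         ≡⟨ +-assoc (f v) (excess v) (count v) ⟩
  f v + (excess v + count v)       ≡⟨ cong (f v +_) (+-comm (excess v) (count v)) ⟩
  f v + (count v + excess v)       ≡⟨ cong (f v +_) (sum-map≡count-positive+sum-map-pred f (N m n v)) ⟨
  f v + sum (map f (N m n v))      ∎
  where
  open ≤-Reasoning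
  count excess : Vertex m n → ℕ
  count v = length (filter (λ u → 0 <? f u) (N m n v))
  excess v = sum (map (λ u → f u ∸ 1) (N m n v))

residue : Fin 5 → ℕ → Fin 5
residue i zero    = i
residue i (suc c) = rot (rot (residue i c))

residue-comm : ∀ (σ : Fin 5 → Fin 5) → (∀ s → σ (rot s) ≡ rot (σ s)) →
  ∀ i c → residue (σ i) c ≡ σ (residue i c)
residue-comm σ comm i zero    = refl
residue-comm σ comm i (suc c) = begin
  rot (rot (residue (σ i) c)) ≡⟨ cong (rot ∘ rot) (residue-comm σ comm i c) ⟩
  rot (rot (σ s))             ≡⟨ cong rot (comm s) ⟨
  rot (σ (rot s))             ≡⟨ comm (rot s) ⟨
  σ (rot (rot s))             ∎
  where
  open ≡-Reasoning
  s : Fin 5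
  s = residue i c

residue-rot : ∀ i c → residue (rot i) c ≡ rot (residue i c)
residue-rot = residue-comm rot (λ _ → refl)

residue-rot⁻¹ : ∀ i c → residue (rot⁻¹ i) c ≡ rot⁻¹ (residue i c)
residue-rot⁻¹ = residue-comm rot⁻¹ (λ s → trans (rot⁻¹-rot s) (sym (rot-rot⁻¹ s)))

diagonal : (ℕ → Fin 5 → ℕ) → Fin 5 → ℕ → ℕ
diagonal C i c = C c (residue i c)

belowOf : (ℕ → Fin 5 → ℕ) → ℕ → Fin 5 → ℕ
belowOf C zero    s = 0
belowOf C (suc c) s = C c (rot⁻¹ (rot⁻¹ s))

aboveOf : ℕ → (ℕ → Fin 5 → ℕ) → ℕ → Fin 5 → ℕ
aboveOf n C c s = if suc c <ᵇ n then C (suc c) (rot (rot s)) else 0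

prev-diagonal : ∀ C i c → prev (diagonal C i) c ≡ belowOf C c (residue i c)
prev-diagonal C i zero    = refl
prev-diagonal C i (suc c) =
  cong (C c) (sym (trans (cong rot⁻¹ (rot⁻¹-rot (rot (residue i c)))) (rot⁻¹-rot (residue i c))))

coverageAt : ℕ → (ℕ → Fin 5 → ℕ) → ℕ → Fin 5 → ℕ
coverageAt n C c s = coverage (C c s) (belowOf C c s) (aboveOf n C c s) (C c (rot s)) (C c (rot⁻¹ s))

coverageAt-mono : ∀ n C c s {a b d e f} → a ≤ C c s → b ≤ belowOf C c s → d ≤ aboveOf n C c s →
  e ≤ C c (rot s) → f ≤ C c (rot⁻¹ s) → coverage a b d e f ≤ coverageAt n C c s
coverageAt-mono n C c s a b d e f =
  +-mono-≤ a (+-mono-≤ (+-mono-≤ (∸-monoˡ-≤ 1 b) (∸-monoˡ-≤ 1 d))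
                       (+-mono-≤ (∸-monoˡ-≤ 1 e) (∸-monoˡ-≤ 1 f)))

Covers : ℕ → ℕ → (ℕ → Fin 5 → ℕ) → Set
Covers k n C = ∀ c s → c < n → k ≤ coverageAt n C c s

diagonal-isKRDF : ∀ k n (C : ℕ → Fin 5 → ℕ) → (∀ c s → C c s ≤ k + 1) → Covers k n C →
  IsKRDF k 5 n (label (diagonal C))
diagonal-isKRDF k n C bounded covers =
  isKRDF-from-coverage (label (diagonal C)) (λ (i , j) → bounded (toℕ j) (residue i (toℕ j))) covered
  where
  covered : ∀ v → k ≤ label (diagonal C) v + sum (map (λ u → label (diagonal C) u ∸ 1) (N 5 n v))
  covered (i , j) = begin
    k
      ≤⟨ covers c s (toℕ<n j) ⟩
    coverage (C c s) (belowOf C c s) (aboveOf n C c s) (C c (rot s)) (C c (rot⁻¹ s))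
      ≡⟨ cong₂ (λ b r → coverage (C c s) b (aboveOf n C c s) r (C c (rot⁻¹ s)))
               (sym (prev-diagonal C i c)) (cong (C c) (sym (residue-rot i c))) ⟩
    coverage (C c s) (prev (diagonal C i) c) (aboveOf n C c s) (C c (residue (rot i) c)) (C c (rot⁻¹ s))
      ≡⟨ cong (λ l → coverage (C c s) (prev (diagonal C i) c) (aboveOf n C c s) (C c (residue (rot i) c)) l)
              (cong (C c) (sym (residue-rot⁻¹ i c))) ⟩
    coverage (C c s) (prev (diagonal C i) c) (next n (diagonal C i) c)
             (diagonal C (rot i) c) (diagonal C (rot⁻¹ i) c)
      ≡⟨ coverage-label n (diagonal C) i j ⟨
    label (diagonal C) (i , j) + sum (map (λ u → label (diagonal C) u ∸ 1) (N 5 n (i , j))) ∎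
    where
    open ≤-Reasoning
    c : ℕ
    c = toℕ j
    s : Fin 5
    s = residue i c

∑-rot² : ∀ (W : Fin 5 → ℕ) → ∑[ s < 5 ] W (rot (rot s)) ≡ ∑[ s < 5 ] W s
∑-rot² W = rotate (W 0F) (W 1F) (W 2F) (W 3F) (W 4F)
  where
  rotate : ∀ a b c d e → c + (d + (e + (a + (b + 0)))) ≡ a + (b + (c + (d + (e + 0))))
  rotate = solve-∀

∑-residue : ∀ c (W : Fin 5 → ℕ) → ∑[ i < 5 ] W (residue i c) ≡ ∑[ s < 5 ] W s
∑-residue zero    W = refl
∑-residue (suc c) W = trans (∑-residue c (W ∘ rot ∘ rot)) (∑-rot² W)

weight-diagonal : ∀ n C → weight 5 n (label (diagonal C)) ≡ ∑[ j < n ] ∑[ s < 5 ] C (toℕ j) s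
weight-diagonal n C = begin
  weight 5 n (label (diagonal C))          ≡⟨ sum-map-vertices 5 n _ ⟩
  ∑[ i < 5 ] ∑[ j < n ] diagonal C i (toℕ j) ≡⟨ ∑-comm {5} {n} (λ i j → diagonal C i (toℕ j)) ⟩
  ∑[ j < n ] ∑[ i < 5 ] diagonal C i (toℕ j) ≡⟨ sum-cong-≗ {n} (λ j → ∑-residue (toℕ j) (C (toℕ j))) ⟩
  ∑[ j < n ] ∑[ s < 5 ] C (toℕ j) s        ∎
  where open ≡-Reasoning

-- The strip and square labellings

m+o≡n⇒m≤n : ∀ {m} n o → m + o ≡ n → m ≤ n
m+o≡n⇒m≤n {m} n o refl = m≤m+n m o

cells : ℕ → ℕ → ℕ → ℕ → ℕ → Fin 5 → ℕ
cells a b c d e 0F = a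
cells a b c d e 1F = b
cells a b c d e 2F = c
cells a b c d e 3F = d
cells a b c d e 4F = e

cells-≤ : ∀ {a b c d e m} → a ≤ m → b ≤ m → c ≤ m → d ≤ m → e ≤ m →
  ∀ s → cells a b c d e s ≤ m
cells-≤ a _ _ _ _ 0F = a
cells-≤ _ b _ _ _ 1F = b
cells-≤ _ _ c _ _ 2F = c
cells-≤ _ _ _ d _ 3F = d
cells-≤ _ _ _ _ e 4F = e

module Strip (X Y Z : ℕ) (Z≤Y : Z ≤ Y) (Y≤X : Y ≤ X) (X≤1+Z : X ≤ suc Z) where

  column : Bool → Bool → Fin 5 → ℕ
  column first last =
    cells (suc X) (suc Y) (suc Z) (if first then suc Z else 0) (if last then suc X else 0)

  motif : Fin 5 → ℕ
  motif = column false false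

  strip : ℕ → ℕ → Fin 5 → ℕ
  strip n c = column (0 ≡ᵇ c) (n ≡ᵇ suc c)

  private
    Z≤X : Z ≤ X
    Z≤X = ≤-trans Z≤Y Y≤X
    Y≤1+Z : Y ≤ suc Z
    Y≤1+Z = ≤-trans Y≤X X≤1+Z
    Y≤1+X : Y ≤ suc X
    Y≤1+X = ≤-trans Y≤X (n≤1+n X)
    Z≤1+X : Z ≤ suc X
    Z≤1+X = ≤-trans Z≤X (n≤1+n X)

  motif≤column : ∀ first last s → motif s ≤ column first last s
  motif≤column _ _ 0F = ≤-refl
  motif≤column _ _ 1F = ≤-refl
  motif≤column _ _ 2F = ≤-refl
  motif≤column _ _ 3F = z≤n
  motif≤column _ _ 4F = z≤n

  motif≤strip : ∀ n c s → motif s ≤ strip n c s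
  motif≤strip n c = motif≤column (0 ≡ᵇ c) (n ≡ᵇ suc c)

  column≤k+1 : ∀ first last s → column first last s ≤ X + Y + Z + 1
  column≤k+1 first last s = ≤-trans
    (cells-≤ ≤-refl (s≤s Y≤X) (s≤s Z≤X) (if-≤ first (s≤s Z≤X)) (if-≤ last ≤-refl) s)
    (m+o≡n⇒m≤n (X + Y + Z + 1) (Y + Z) (solve (X ∷ Y ∷ Z ∷ [])))

  -- The hypotheses on X, Y, Z enter exactly where an end
  -- column misses a residue.
  first-covers : ∀ s → X + Y + Z ≤
    coverage (column true false s) 0 (motif (rot (rot s)))
             (column true false (rot s)) (column true false (rot⁻¹ s))
  first-covers 0F = m+o≡n⇒m≤n (suc X + ((0 + Z) + (Y + 0))) 1 (solve (X ∷ Y ∷ Z ∷ []))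
  first-covers 1F = m+o≡n⇒m≤n (suc Y + ((0 + 0) + (Z + X))) 1 (solve (X ∷ Y ∷ Z ∷ []))
  first-covers 2F = ≤-trans {j = suc Z + Y + Z} (+-monoˡ-≤ Z (+-monoˡ-≤ Y X≤1+Z))
    (m+o≡n⇒m≤n (suc Z + ((0 + 0) + (Z + Y))) 0 (solve (X ∷ Y ∷ Z ∷ [])))
  first-covers 3F = ≤-trans {j = X + suc Z + Z} (+-monoˡ-≤ Z (+-monoʳ-≤ X Y≤1+Z))
    (m+o≡n⇒m≤n (suc Z + ((0 + X) + (0 + Z))) 0 (solve (X ∷ Y ∷ Z ∷ [])))
  first-covers 4F = m+o≡n⇒m≤n (0 + ((0 + Y) + (X + Z))) 0 (solve (X ∷ Y ∷ Z ∷ []))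

  middle-covers : ∀ s → X + Y + Z ≤
    coverage (motif s) (motif (rot⁻¹ (rot⁻¹ s))) (motif (rot (rot s))) (motif (rot s)) (motif (rot⁻¹ s))
  middle-covers 0F = m+o≡n⇒m≤n (suc X + ((0 + Z) + (Y + 0))) 1 (solve (X ∷ Y ∷ Z ∷ []))
  middle-covers 1F = m+o≡n⇒m≤n (suc Y + ((0 + 0) + (Z + X))) 1 (solve (X ∷ Y ∷ Z ∷ []))
  middle-covers 2F = m+o≡n⇒m≤n (suc Z + ((X + 0) + (0 + Y))) 1 (solve (X ∷ Y ∷ Z ∷ []))
  middle-covers 3F = m+o≡n⇒m≤n (0 + ((Y + X) + (0 + Z))) 0 (solve (X ∷ Y ∷ Z ∷ []))
  middle-covers 4F = m+o≡n⇒m≤n (0 + ((Z + Y) + (X + 0))) 0 (solve (X ∷ Y ∷ Z ∷ []))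

  last-covers : ∀ s → X + Y + Z ≤
    coverage (column false true s) (motif (rot⁻¹ (rot⁻¹ s))) 0
             (column false true (rot s)) (column false true (rot⁻¹ s))
  last-covers 0F = ≤-trans {j = X + Y + suc X} (+-monoʳ-≤ (X + Y) Z≤1+X)
    (m+o≡n⇒m≤n (suc X + ((0 + 0) + (Y + X))) 0 (solve (X ∷ Y ∷ Z ∷ [])))
  last-covers 1F = m+o≡n⇒m≤n (suc Y + ((0 + 0) + (Z + X))) 1 (solve (X ∷ Y ∷ Z ∷ []))
  last-covers 2F = m+o≡n⇒m≤n (suc Z + ((X + 0) + (0 + Y))) 1 (solve (X ∷ Y ∷ Z ∷ []))
  last-covers 3F = m+o≡n⇒m≤n (0 + ((Y + 0) + (X + Z))) 0 (solve (X ∷ Y ∷ Z ∷ []))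
  last-covers 4F = ≤-trans {j = X + suc X + Z} (+-monoˡ-≤ Z (+-monoʳ-≤ X Y≤1+X))
    (m+o≡n⇒m≤n (suc X + ((Z + 0) + (X + 0))) 0 (solve (X ∷ Y ∷ Z ∷ [])))

  strip-covers : ∀ m → Covers (X + Y + Z) (2 + m) (strip (2 + m))
  strip-covers m zero s _ = ≤-trans (first-covers s)
    (coverageAt-mono (2 + m) (strip (2 + m)) 0 s
      ≤-refl ≤-refl (motif≤strip (2 + m) 1 (rot (rot s))) ≤-refl ≤-refl)
  strip-covers m (suc c) s (s≤s c<1+m) with m≤n⇒m<n∨m≡n c<1+m
  ... | inj₁ 2+c<2+m = ≤-trans (middle-covers s)
    (coverageAt-mono n (strip n) (suc c) s
      (motif≤strip n (suc c) s) (motif≤strip n c (rot⁻¹ (rot⁻¹ s))) above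
      (motif≤strip n (suc c) (rot s)) (motif≤strip n (suc c) (rot⁻¹ s)))
    where
    n : ℕ
    n = 2 + m
    above : motif (rot (rot s)) ≤ aboveOf n (strip n) (suc c) s
    above = ≤-trans (motif≤strip n (2 + c) (rot (rot s))) (≤-reflexive (sym (if-T _ (<⇒<ᵇ (s≤s 2+c<2+m)))))
  ... | inj₂ refl = ≤-trans (last-covers s)
    (coverageAt-mono (2 + m) (strip (2 + m)) (suc m) s
      (≤-reflexive (sym (is-last s))) (motif≤strip (2 + m) m (rot⁻¹ (rot⁻¹ s))) z≤n
      (≤-reflexive (sym (is-last (rot s)))) (≤-reflexive (sym (is-last (rot⁻¹ s)))))
    where
    is-last : ∀ s → strip (2 + m) (suc m) s ≡ column false true s
    is-last s = cong (λ b → column false b s) (≡ᵇ-refl m)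

  strip-bounded : ∀ n c s → strip n c s ≤ X + Y + Z + 1
  strip-bounded n c = column≤k+1 (0 ≡ᵇ c) (n ≡ᵇ suc c)

  strip-weight : ∀ m →
    weight 5 (2 + m) (label (diagonal (strip (2 + m)))) ≡ (2 + m) * (X + Y + Z + 3) + suc Z + suc X
  strip-weight m = begin
    weight 5 n (label (diagonal (strip n)))
      ≡⟨ weight-diagonal n (strip n) ⟩
    ∑[ j < n ] ∑[ s < 5 ] strip n (toℕ j) s
      ≡⟨ sum-cong-≗ {n} (λ j → regroup X Y Z (first j) (last j)) ⟩
    ∑[ j < n ] (K + first j + last j)
      ≡⟨ ∑-distrib-+ {n} (λ j → K + first j) last ⟩
    ∑[ j < n ] (K + first j) + ∑[ j < n ] last j
      ≡⟨ cong (_+ ∑[ j < n ] last j) (∑-distrib-+ {n} (λ _ → K) first) ⟩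
    ∑[ j < n ] K + ∑[ j < n ] first j + ∑[ j < n ] last j
      ≡⟨ cong₂ _+_ (cong₂ _+_ (∑-const n K) (∑-point n 0 (λ _ → suc Z)))
                   (trans (∑-point n (suc m) (λ _ → suc X)) (if-T (suc X) (<⇒<ᵇ (n<1+n m)))) ⟩
    n * K + suc Z + suc X
      ∎
    where
    open ≡-Reasoning
    n : ℕ
    n = 2 + m
    K : ℕ
    K = X + Y + Z + 3
    first last : Fin n → ℕ
    first j = if 0 ≡ᵇ toℕ j then suc Z else 0
    last j = if n ≡ᵇ suc (toℕ j) then suc X else 0
    regroup : ∀ X Y Z a b → suc X + (suc Y + (suc Z + (a + (b + 0)))) ≡ X + Y + Z + 3 + a + b
    regroup = solve-∀

-- For n = 4 the strip labelling (with X = suc X′) can be lowered by one: decrease residue 0 of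
-- both end columns and increase residue 1 of column 1, the cell adjacent to both vertices that
-- would otherwise lose coverage.
module Square (X′ Y Z : ℕ) (Z≤Y : Z ≤ Y) (Y≤1+X′ : Y ≤ suc X′) (X′≤Z : X′ ≤ Z) where

  square : ℕ → Fin 5 → ℕ
  square 0 = cells (suc X′) (suc Y) (suc Z) (suc Z) 0
  square 1 = cells (suc (suc X′)) (suc (suc Y)) (suc Z) 0 0
  square 2 = cells (suc (suc X′)) (suc Y) (suc Z) 0 0
  square 3 = cells (suc X′) (suc Y) (suc Z) 0 (suc (suc X′))
  square _ = cells 0 0 0 0 0

  private
    Y≤1+Z : Y ≤ suc Z
    Y≤1+Z = ≤-trans Y≤1+X′ (s≤s X′≤Z)
    Z≤1+X′ : Z ≤ suc X′
    Z≤1+X′ = ≤-trans Z≤Y Y≤1+X′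
    1+X′≤k+1 : suc X′ ≤ suc X′ + Y + Z + 1
    1+X′≤k+1 = m+o≡n⇒m≤n (suc X′ + Y + Z + 1) (Y + Z + 1) (solve (X′ ∷ Y ∷ Z ∷ []))
    2+X′≤k+1 : suc (suc X′) ≤ suc X′ + Y + Z + 1
    2+X′≤k+1 = m+o≡n⇒m≤n (suc X′ + Y + Z + 1) (Y + Z) (solve (X′ ∷ Y ∷ Z ∷ []))
    1+Y≤k+1 : suc Y ≤ suc X′ + Y + Z + 1
    1+Y≤k+1 = m+o≡n⇒m≤n (suc X′ + Y + Z + 1) (suc X′ + Z) (solve (X′ ∷ Y ∷ Z ∷ []))
    2+Y≤k+1 : suc (suc Y) ≤ suc X′ + Y + Z + 1
    2+Y≤k+1 = m+o≡n⇒m≤n (suc X′ + Y + Z + 1) (X′ + Z) (solve (X′ ∷ Y ∷ Z ∷ []))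
    1+Z≤k+1 : suc Z ≤ suc X′ + Y + Z + 1
    1+Z≤k+1 = m+o≡n⇒m≤n (suc X′ + Y + Z + 1) (suc X′ + Y) (solve (X′ ∷ Y ∷ Z ∷ []))

  square-bounded : ∀ c s → square c s ≤ suc X′ + Y + Z + 1
  square-bounded 0 = cells-≤ 1+X′≤k+1 1+Y≤k+1 1+Z≤k+1 1+Z≤k+1 z≤n
  square-bounded 1 = cells-≤ 2+X′≤k+1 2+Y≤k+1 1+Z≤k+1 z≤n z≤n
  square-bounded 2 = cells-≤ 2+X′≤k+1 1+Y≤k+1 1+Z≤k+1 z≤n z≤n
  square-bounded 3 = cells-≤ 1+X′≤k+1 1+Y≤k+1 1+Z≤k+1 z≤n 2+X′≤k+1
  square-bounded (suc (suc (suc (suc _)))) = cells-≤ z≤n z≤n z≤n z≤n z≤n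

  square-weight : weight 5 4 (label (diagonal square)) + 4 ≡ 4 * (suc X′ + Y + Z) + 17 + Z + suc X′
  square-weight = trans (cong (_+ 4) (weight-diagonal 4 square)) (sums X′ Y Z)
    where
    sums : ∀ X′ Y Z →
      (suc X′ + (suc Y + (suc Z + (suc Z + (0 + 0))))) +
      ((suc (suc X′) + (suc (suc Y) + (suc Z + (0 + (0 + 0))))) +
      ((suc (suc X′) + (suc Y + (suc Z + (0 + (0 + 0))))) +
      ((suc X′ + (suc Y + (suc Z + (0 + (suc (suc X′) + 0))))) + 0))) + 4
      ≡ 4 * (suc X′ + Y + Z) + 17 + Z + suc X′
    sums = solve-∀

  square-covers : Covers (suc X′ + Y + Z) 4 square
  square-covers 0 0F _ = m+o≡n⇒m≤n (suc X′ + ((0 + Z) + (Y + 0))) 0 (solve (X′ ∷ Y ∷ Z ∷ []))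
  square-covers 0 1F _ = m+o≡n⇒m≤n (suc Y + ((0 + 0) + (Z + X′))) 0 (solve (X′ ∷ Y ∷ Z ∷ []))
  square-covers 0 2F _ = ≤-trans {j = suc Z + Y + Z} (+-monoˡ-≤ Z (+-monoˡ-≤ Y (s≤s X′≤Z)))
    (m+o≡n⇒m≤n (suc Z + ((0 + 0) + (Z + Y))) 0 (solve (X′ ∷ Y ∷ Z ∷ [])))
  square-covers 0 3F _ = ≤-trans {j = suc X′ + suc Z + Z} (+-monoˡ-≤ Z (+-monoʳ-≤ (suc X′) Y≤1+Z))
    (m+o≡n⇒m≤n (suc Z + ((0 + suc X′) + (0 + Z))) 0 (solve (X′ ∷ Y ∷ Z ∷ [])))
  square-covers 0 4F _ = m+o≡n⇒m≤n (0 + ((0 + suc Y) + (X′ + Z))) 0 (solve (X′ ∷ Y ∷ Z ∷ []))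
  square-covers 1 0F _ = m+o≡n⇒m≤n (suc (suc X′) + ((Z + Z) + (suc Y + 0))) (Z + 2) (solve (X′ ∷ Y ∷ Z ∷ []))
  square-covers 1 1F _ = m+o≡n⇒m≤n (suc (suc Y) + ((0 + 0) + (Z + suc X′))) 2 (solve (X′ ∷ Y ∷ Z ∷ []))
  square-covers 1 2F _ = m+o≡n⇒m≤n (suc Z + ((X′ + 0) + (0 + suc Y))) 1 (solve (X′ ∷ Y ∷ Z ∷ []))
  square-covers 1 3F _ = m+o≡n⇒m≤n (0 + ((Y + suc X′) + (0 + Z))) 0 (solve (X′ ∷ Y ∷ Z ∷ []))
  square-covers 1 4F _ = m+o≡n⇒m≤n (0 + ((Z + Y) + (suc X′ + 0))) 0 (solve (X′ ∷ Y ∷ Z ∷ []))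
  square-covers 2 0F _ = m+o≡n⇒m≤n (suc (suc X′) + ((0 + Z) + (Y + 0))) 1 (solve (X′ ∷ Y ∷ Z ∷ []))
  square-covers 2 1F _ = m+o≡n⇒m≤n (suc Y + ((0 + 0) + (Z + suc X′))) 1 (solve (X′ ∷ Y ∷ Z ∷ []))
  square-covers 2 2F _ = m+o≡n⇒m≤n (suc Z + ((suc X′ + suc X′) + (0 + Y))) (X′ + 2) (solve (X′ ∷ Y ∷ Z ∷ []))
  square-covers 2 3F _ = m+o≡n⇒m≤n (0 + ((suc Y + X′) + (0 + Z))) 0 (solve (X′ ∷ Y ∷ Z ∷ []))
  square-covers 2 4F _ = m+o≡n⇒m≤n (0 + ((Z + Y) + (suc X′ + 0))) 0 (solve (X′ ∷ Y ∷ Z ∷ []))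
  square-covers 3 0F _ = ≤-trans {j = suc X′ + Y + suc X′} (+-monoʳ-≤ (suc X′ + Y) Z≤1+X′)
    (m+o≡n⇒m≤n (suc X′ + ((0 + 0) + (Y + suc X′))) 0 (solve (X′ ∷ Y ∷ Z ∷ [])))
  square-covers 3 1F _ = m+o≡n⇒m≤n (suc Y + ((0 + 0) + (Z + X′))) 0 (solve (X′ ∷ Y ∷ Z ∷ []))
  square-covers 3 2F _ = m+o≡n⇒m≤n (suc Z + ((suc X′ + 0) + (0 + Y))) 1 (solve (X′ ∷ Y ∷ Z ∷ []))
  square-covers 3 3F _ = m+o≡n⇒m≤n (0 + ((Y + 0) + (suc X′ + Z))) 0 (solve (X′ ∷ Y ∷ Z ∷ []))
  square-covers 3 4F _ = ≤-trans {j = suc X′ + suc X′ + Z} (+-monoˡ-≤ Z (+-monoʳ-≤ (suc X′) Y≤1+X′))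
    (m+o≡n⇒m≤n (suc (suc X′) + ((Z + 0) + (X′ + 0))) 0 (solve (X′ ∷ Y ∷ Z ∷ [])))
  square-covers (suc (suc (suc (suc c)))) s (s≤s (s≤s (s≤s (s≤s ()))))

-- The arithmetic of the bound

periodic : ∀ p .{{_ : NonZero p}} {P : ℕ → Set} →
  (∀ {r} → r < p → P r) → (∀ k → P k → P (k + p)) → ∀ k → P k
periodic p {P} base step k = subst P (sym (m≡m%n+[m/n]*n k p)) (from-quotient (k / p))
  where
  from-quotient : ∀ q → P (k % p + q * p)
  from-quotient zero    = subst P (sym (+-identityʳ (k % p))) (base (m%n<n k p))
  from-quotient (suc q) = subst P (trans (+-assoc (k % p) (q * p) p) (cong (k % p +_) (+-comm (q * p) p)))
                                (step _ (from-quotient q))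

[m+kn]/n≡m/n+k : ∀ m k n .{{_ : NonZero n}} → (m + k * n) / n ≡ m / n + k
[m+kn]/n≡m/n+k m k n = trans (+-distrib-/-∣ʳ m (divides-refl k)) (cong (m / n +_) (m*n/n≡m k n))

⌈m+kn/n⌉≡⌈m/n⌉+k : ∀ m k n .{{_ : NonZero n}} → ⌈ m + k * n / n ⌉ ≡ ⌈ m / n ⌉ + k
⌈m+kn/n⌉≡⌈m/n⌉+k m k n@(suc n-1) = trans (cong (_/ n) numerator) ([m+kn]/n≡m/n+k (m + n ∸ 1) k n)
  where
  numerator : m + k * n + n ∸ 1 ≡ m + n ∸ 1 + k * n
  numerator = trans (cong (_∸ 1) (xy∙z≈xz∙y m (k * n) n))
                    (+-∸-comm (k * n) (≤-trans (s≤s z≤n) (m≤n+m n m)))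

⌈m/n⌉*n≤m+n∸1 : ∀ m n .{{_ : NonZero n}} → ⌈ m / n ⌉ * n ≤ m + n ∸ 1
⌈m/n⌉*n≤m+n∸1 m n = m/n*n≤m (m + n ∸ 1) n

m≤⌈m/n⌉*n : ∀ m n .{{_ : NonZero n}} → m ≤ ⌈ m / n ⌉ * n
m≤⌈m/n⌉*n m n@(suc n-1) = +-cancelʳ-≤ n-1 m (⌈ m / n ⌉ * n) (begin
  m + n-1                              ≡⟨ +-∸-assoc m {n} (s≤s z≤n) ⟨
  m + n ∸ 1                            ≡⟨ m≡m%n+[m/n]*n (m + n ∸ 1) n ⟩
  (m + n ∸ 1) % n + ⌈ m / n ⌉ * n     ≤⟨ +-monoˡ-≤ _ (<⇒≤pred (m%n<n (m + n ∸ 1) n)) ⟩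
  n-1 + ⌈ m / n ⌉ * n                  ≡⟨ +-comm n-1 _ ⟩
  ⌈ m / n ⌉ * n + n-1                  ∎)
  where open ≤-Reasoning

c : ℕ → ℕ
c k = ⌈ k + 5 / 5 ⌉

d : ℕ → ℕ
d k = ⌈ k + 3 ∸ c k / 3 ⌉

k+5≤c*5 : ∀ k → k + 5 ≤ c k * 5
k+5≤c*5 k = m≤⌈m/n⌉*n (k + 5) 5

c*5≤k+9 : ∀ k → c k * 5 ≤ k + 9
c*5≤k+9 k = begin
  c k * 5        ≤⟨ ⌈m/n⌉*n≤m+n∸1 (k + 5) 5 ⟩
  k + 5 + 5 ∸ 1  ≡⟨ cong (_∸ 1) (+-assoc k 5 5) ⟩
  k + 10 ∸ 1     ≡⟨ +-∸-assoc k {10} (s≤s z≤n) ⟩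
  k + 9          ∎
  where open ≤-Reasoning

c≤k+3 : ∀ k → c k ≤ k + 3
c≤k+3 k = *-cancelʳ-≤ (c k) (k + 3) 5 (begin
  c k * 5              ≤⟨ c*5≤k+9 k ⟩
  k + 9                ≤⟨ m≤m+n (k + 9) (k * 4 + 6) ⟩
  k + 9 + (k * 4 + 6)  ≡⟨ solve (k ∷ []) ⟩
  (k + 3) * 5          ∎)
  where open ≤-Reasoning

d*3+c≤k+5 : ∀ k → d k * 3 + c k ≤ k + 5
d*3+c≤k+5 k = begin
  d k * 3 + c k                  ≤⟨ +-monoˡ-≤ (c k) (⌈m/n⌉*n≤m+n∸1 (k + 3 ∸ c k) 3) ⟩
  (k + 3 ∸ c k) + 3 ∸ 1 + c k    ≡⟨ cong (_+ c k) (+-∸-assoc (k + 3 ∸ c k) {3} (s≤s z≤n)) ⟩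
  (k + 3 ∸ c k) + 2 + c k        ≡⟨ xy∙z≈xz∙y (k + 3 ∸ c k) 2 (c k) ⟩
  (k + 3 ∸ c k) + c k + 2        ≡⟨ cong (_+ 2) (m∸n+n≡m (c≤k+3 k)) ⟩
  k + 3 + 2                      ≡⟨ +-assoc k 3 2 ⟩
  k + 5                          ∎
  where open ≤-Reasoning

c-shift : ∀ k → c (k + 15) ≡ c k + 3
c-shift k = trans (cong ⌈_/ 5 ⌉ (shift k)) (⌈m+kn/n⌉≡⌈m/n⌉+k (k + 5) 3 5)
  where
  shift : ∀ k → k + 15 + 5 ≡ k + 5 + 3 * 5
  shift = solve-∀

d-shift : ∀ k → d (k + 15) ≡ d k + 4
d-shift k = begin
  ⌈ k + 15 + 3 ∸ c (k + 15) / 3 ⌉   ≡⟨ cong (λ x → ⌈ k + 15 + 3 ∸ x / 3 ⌉) (c-shift k) ⟩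
  ⌈ k + 15 + 3 ∸ (c k + 3) / 3 ⌉    ≡⟨ cong ⌈_/ 3 ⌉ numerator ⟩
  ⌈ k + 3 ∸ c k + 4 * 3 / 3 ⌉       ≡⟨ ⌈m+kn/n⌉≡⌈m/n⌉+k (k + 3 ∸ c k) 4 3 ⟩
  d k + 4                           ∎
  where
  open ≡-Reasoning
  rearrange : ∀ k → k + 15 + 3 ≡ 3 + (k + 3 + 12)
  rearrange = solve-∀
  numerator : k + 15 + 3 ∸ (c k + 3) ≡ k + 3 ∸ c k + 12
  numerator = begin
    k + 15 + 3 ∸ (c k + 3)       ≡⟨ cong₂ _∸_ (rearrange k) (+-comm (c k) 3) ⟩
    3 + (k + 3 + 12) ∸ (3 + c k) ≡⟨ [m+n]∸[m+o]≡n∸o 3 (k + 3 + 12) (c k) ⟩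
    k + 3 + 12 ∸ c k             ≡⟨ +-∸-comm 12 (c≤k+3 k) ⟩
    k + 3 ∸ c k + 12             ∎

lo mid hi : ℕ → ℕ
lo k = k / 3
mid k = suc k / 3
hi k = suc (suc k) / 3

hi+mid+lo≡k : ∀ k → hi k + mid k + lo k ≡ k
hi+mid+lo≡k = periodic 3 (from-yes (allUpTo? (λ k → hi k + mid k + lo k ≟ k) 3)) step
  where
  step : ∀ k → hi k + mid k + lo k ≡ k → hi (k + 3) + mid (k + 3) + lo (k + 3) ≡ k + 3
  step k eq = begin
    hi (k + 3) + mid (k + 3) + lo (k + 3)
      ≡⟨ cong₂ _+_ (cong₂ _+_ ([m+kn]/n≡m/n+k (suc (suc k)) 1 3) ([m+kn]/n≡m/n+k (suc k) 1 3))
                   ([m+kn]/n≡m/n+k k 1 3) ⟩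
    (hi k + 1) + (mid k + 1) + (lo k + 1)
      ≡⟨ regroup (hi k) (mid k) (lo k) ⟩
    hi k + mid k + lo k + 3
      ≡⟨ cong (_+ 3) eq ⟩
    k + 3 ∎
    where
    open ≡-Reasoning
    regroup : ∀ x y z → (x + 1) + (y + 1) + (z + 1) ≡ x + y + z + 3
    regroup = solve-∀

lo≤mid : ∀ k → lo k ≤ mid k
lo≤mid k = /-monoˡ-≤ 3 (n≤1+n k)

mid≤hi : ∀ k → mid k ≤ hi k
mid≤hi k = /-monoˡ-≤ 3 (n≤1+n (suc k))

hi≤1+lo : ∀ k → hi k ≤ suc (lo k)
hi≤1+lo k = begin
  suc (suc k) / 3  ≤⟨ /-monoˡ-≤ 3 (n≤1+n (suc (suc k))) ⟩
  (3 + k) / 3      ≡⟨ cong (_/ 3) (+-comm 3 k) ⟩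
  (k + 1 * 3) / 3  ≡⟨ [m+kn]/n≡m/n+k k 1 3 ⟩
  lo k + 1         ≡⟨ +-comm (lo k) 1 ⟩
  suc (lo k)       ∎
  where open ≤-Reasoning

1≤hi : ∀ {k} → 1 ≤ k → 1 ≤ hi k
1≤hi {suc k} _ = m≥n⇒m/n>0 {3 + k} (s≤s (s≤s (s≤s z≤n)))

square-budget : ∀ k → 4 * k + 17 + lo k + hi k ≤ 10 * c k + 10 * d k
square-budget =
  periodic 15 (from-yes (allUpTo? (λ k → 4 * k + 17 + lo k + hi k ≤? 10 * c k + 10 * d k) 15)) step
  where
  step : ∀ k → 4 * k + 17 + lo k + hi k ≤ 10 * c k + 10 * d k →
         4 * (k + 15) + 17 + lo (k + 15) + hi (k + 15) ≤ 10 * c (k + 15) + 10 * d (k + 15)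
  step k le = begin
    4 * (k + 15) + 17 + lo (k + 15) + hi (k + 15)
      ≡⟨ cong₂ (λ l h → 4 * (k + 15) + 17 + l + h) ([m+kn]/n≡m/n+k k 5 3) ([m+kn]/n≡m/n+k (suc (suc k)) 5 3) ⟩
    4 * (k + 15) + 17 + (lo k + 5) + (hi k + 5)
      ≡⟨ left k (lo k) (hi k) ⟩
    4 * k + 17 + lo k + hi k + 70
      ≤⟨ +-monoˡ-≤ 70 le ⟩
    10 * c k + 10 * d k + 70
      ≡⟨ right (c k) (d k) ⟩
    10 * (c k + 3) + 10 * (d k + 4)
      ≡⟨ cong₂ (λ a b → 10 * a + 10 * b) (c-shift k) (d-shift k) ⟨
    10 * c (k + 15) + 10 * d (k + 15) ∎
    where
    open ≤-Reasoning
    left : ∀ k l h → 4 * (k + 15) + 17 + (l + 5) + (h + 5) ≡ 4 * k + 17 + l + h + 70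
    left = solve-∀
    right : ∀ u v → 10 * u + 10 * v + 70 ≡ 10 * (u + 3) + 10 * (v + 4)
    right = solve-∀

strip-budget : ∀ p k →
  (5 + p) * (k + 3) + suc (lo k) + suc (hi k) + (5 + p) ≤ 5 * (3 + p) * c k + 10 * d k
strip-budget p k = arith p k (lo k) (hi k) (c k) (d k) (square-budget k) (k+5≤c*5 k)
  where
  arith : ∀ p k l h u v → 4 * k + 17 + l + h ≤ 10 * u + 10 * v → k + 5 ≤ u * 5 →
          (5 + p) * (k + 3) + suc l + suc h + (5 + p) ≤ 5 * (3 + p) * u + 10 * v
  arith p k l h u v square k+5≤5u = begin
    (5 + p) * (k + 3) + suc l + suc h + (5 + p)   ≡⟨ solve (p ∷ k ∷ l ∷ h ∷ []) ⟩
    (4 * k + 17 + l + h) + (k + 5) + p * (k + 4)  ≤⟨ +-mono-≤ (+-mono-≤ square k+5≤5u)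
                                                              (*-monoʳ-≤ p (≤-trans (+-monoʳ-≤ k (n≤1+n 4)) k+5≤5u)) ⟩
    (10 * u + 10 * v) + u * 5 + p * (u * 5)       ≡⟨ solve (p ∷ u ∷ v ∷ []) ⟩
    5 * (3 + p) * u + 10 * v                       ∎
    where open ≤-Reasoning

bound≤closed-form : ∀ p k →
  3 * (5 * (2 + p) * c k + 10 * d k) ≤ 3 * (4 + p) * k + 30 * (4 + p) + 2 * k ∸ 10 + 3 * (4 + p)
bound≤closed-form p k = arith p k (c k) (d k) (c*5≤k+9 k) (d*3+c≤k+5 k)
  where
  arith : ∀ p k u v → u * 5 ≤ k + 9 → v * 3 + u ≤ k + 5 →
          3 * (5 * (2 + p) * u + 10 * v) ≤ 3 * (4 + p) * k + 30 * (4 + p) + 2 * k ∸ 10 + 3 * (4 + p)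
  arith p k u v 5u≤k+9 3v+u≤k+5 = begin
    3 * (5 * (2 + p) * u + 10 * v)
      ≡⟨ solve (p ∷ u ∷ v ∷ []) ⟩
    10 * (v * 3 + u) + (4 + 3 * p) * (u * 5)
      ≤⟨ +-mono-≤ (*-monoʳ-≤ 10 3v+u≤k+5) (*-monoʳ-≤ (4 + 3 * p) 5u≤k+9) ⟩
    10 * (k + 5) + (4 + 3 * p) * (k + 9)
      ≤⟨ m≤m+n _ (36 + 6 * p) ⟩
    10 * (k + 5) + (4 + 3 * p) * (k + 9) + (36 + 6 * p)
      ≡⟨ solve (p ∷ k ∷ []) ⟩
    14 * k + 110 + 3 * p * k + 30 * p + 3 * (4 + p)
      ≡⟨ cong (_+ 3 * (4 + p)) (m+n∸m≡n 10 _) ⟨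
    10 + (14 * k + 110 + 3 * p * k + 30 * p) ∸ 10 + 3 * (4 + p)
      ≡⟨ cong (λ x → x ∸ 10 + 3 * (4 + p)) (expand p k) ⟨
    3 * (4 + p) * k + 30 * (4 + p) + 2 * k ∸ 10 + 3 * (4 + p) ∎
    where
    open ≤-Reasoning
    expand : ∀ p k → 3 * (4 + p) * k + 30 * (4 + p) + 2 * k ≡ 10 + (14 * k + 110 + 3 * p * k + 30 * p)
    expand = solve-∀


strip-construction : ∀ k m → Σ (Vertex 5 (2 + m) → ℕ) λ f →
  IsKRDF k 5 (2 + m) f × weight 5 (2 + m) f ≡ (2 + m) * (k + 3) + suc (lo k) + suc (hi k)
strip-construction k m =
  label (diagonal (strip n)) ,
  subst (λ k → IsKRDF k 5 n (label (diagonal (strip n)))) (hi+mid+lo≡k k)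
        (diagonal-isKRDF _ n (strip n) (strip-bounded n) (strip-covers m)) ,
  trans (strip-weight m) (cong (λ t → n * (t + 3) + suc (lo k) + suc (hi k)) (hi+mid+lo≡k k))
  where
  open Strip (hi k) (mid k) (lo k) (lo≤mid k) (mid≤hi k) (hi≤1+lo k)
  n : ℕ
  n = 2 + m

square-construction : ∀ k → 1 ≤ k → Σ (Vertex 5 4 → ℕ) λ f →
  IsKRDF k 5 4 f × weight 5 4 f + 4 ≡ 4 * k + 17 + lo k + hi k
square-construction k 1≤k =
  label (diagonal square) ,
  subst (λ k → IsKRDF k 5 4 (label (diagonal square))) X+Y+Z≡k
        (diagonal-isKRDF _ 4 square square-bounded square-covers) ,
  trans square-weight (cong₂ (λ t h → 4 * t + 17 + lo k + h) X+Y+Z≡k 1+X′≡X)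
  where
  X′ : ℕ
  X′ = pred (hi k)
  1+X′≡X : suc X′ ≡ hi k
  1+X′≡X = suc-pred (hi k) {{>-nonZero (1≤hi 1≤k)}}
  X+Y+Z≡k : suc X′ + mid k + lo k ≡ k
  X+Y+Z≡k = trans (cong (λ h → h + mid k + lo k) 1+X′≡X) (hi+mid+lo≡k k)
  open Square X′ (mid k) (lo k) (lo≤mid k) (subst (mid k ≤_) (sym 1+X′≡X) (mid≤hi k))
                 (≤-pred (subst (_≤ suc (lo k)) (sym 1+X′≡X) (hi≤1+lo k)))

theorem7 : (n k : ℕ) → 4 ≤ n → 1 ≤ k →
    (Σ (Vertex 5 n → ℕ) λ f → IsKRDF k 5 n f ×
      (weight 5 n f + n ≤ 5 * (n ∸ 2) * ⌈ k + 5 / 5 ⌉ + 10 * ⌈ k + 3 ∸ ⌈ k + 5 / 5 ⌉ / 3 ⌉))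
    × (3 * (5 * (n ∸ 2) * ⌈ k + 5 / 5 ⌉ + 10 * ⌈ k + 3 ∸ ⌈ k + 5 / 5 ⌉ / 3 ⌉)
         ≤ 3 * n * k + 30 * n + 2 * k ∸ 10 + 3 * n)
theorem7 (suc (suc (suc (suc p)))) k (s≤s (s≤s (s≤s (s≤s z≤n)))) 1≤k =
  construction p , bound≤closed-form p k
  where
  construction : ∀ p → Σ (Vertex 5 (4 + p) → ℕ) λ f →
    IsKRDF k 5 (4 + p) f × weight 5 (4 + p) f + (4 + p) ≤ 5 * (2 + p) * c k + 10 * d k
  construction zero =
    let (f , f-isKRDF , f-weight) = square-construction k 1≤k
    in f , f-isKRDF , subst (_≤ 10 * c k + 10 * d k) (sym f-weight) (square-budget k)
  construction (suc p) =
    let (f , f-isKRDF , f-weight) = strip-construction k (3 + p)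
    in f , f-isKRDF , subst (λ w → w + (5 + p) ≤ 5 * (3 + p) * c k + 10 * d k) (sym f-weight) (strip-budget p k)
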